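{- The fixed point starting with $0$ of the morphism $0\mapsto 001,\ 1\mapsto 011$ avoids the $xyx$-formula whose fragments are all twelve words $XYX$ with $X,Y\in\{A,B,C,D\}$ and $X\neq Y$.
   Context: A formula is a finite set of non-empty words over variables (fragments), written separated by dots. An occurrence of a formula $f$ in a word $w$ is a non-erasing morphism $h$ from variables to non-empty words such that $h(\phi)$ is a factor of $w$ for every fragment $\phi$; $w$ avoids $f$ if it has no occurrence. -}

module Defs where

open import Data.Nat using (ℕ; zero; suc; _+_)
open import Data.Fin using (Fin; zero; suc)
open import Data.List using (List; []; _∷_; _++_; concatMap; map; upTo; length)
open import Data.List.Relation.Unary.All using (All)
open import Data.Product using (Σ; ∃; _×_)
open import Relation.Binary.PropositionalEquality using (_≡_; _≢_)
open import Relation.Nullary using (¬_)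

Word : Set → Set
Word A = List A

InfWord : Set → Set
InfWord A = ℕ → A

Bit : Set
Bit = Fin 2

σ : Bit → Word Bit
σ zero       = zero ∷ zero ∷ suc zero ∷ []
σ (suc zero) = zero ∷ suc zero ∷ suc zero ∷ []

extend : {A B : Set} → (A → Word B) → Word A → Word B
extend h = concatMap h

σ^_[0] : ℕ → Word Bit
σ^ zero [0]  = zero ∷ []
σ^ suc n [0] = extend σ (σ^ n [0])

lookupD : {A : Set} → A → List A → ℕ → A
lookupD d []       _       = d
lookupD d (x ∷ xs) zero    = x
lookupD d (x ∷ xs) (suc n) = lookupD d xs n

-- The fixed point of σ starting with 0: its n-th letter (0-indexed) is the
-- n-th letter of σ^(n+1)(0), which has length 3^(n+1) > n and is a prefix
-- of the fixed point.  (The default value is never used.)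
fixpoint : InfWord Bit
fixpoint n = lookupD zero (σ^ suc n [0]) n

segment : {A : Set} → InfWord A → ℕ → ℕ → Word A
segment w i m = map (λ k → w (i + k)) (upTo m)

Factor : {A : Set} → Word A → InfWord A → Set
Factor u w = ∃ λ i → segment w i (length u) ≡ u

Formula : ℕ → Set
Formula k = List (Word (Fin k))

Occurrence : {A : Set} {k : ℕ} → Formula k → InfWord A → Set
Occurrence {A} {k} f w =
  Σ (Fin k → Word A) λ h →
    ((X : Fin k) → h X ≢ []) × All (λ φ → Factor (extend h φ) w) f

Avoids : {A : Set} {k : ℕ} → InfWord A → Formula k → Set
Avoids w f = ¬ Occurrence f w

vA vB vC vD : Fin 4
vA = zero
vB = suc zero
vC = suc (suc zero)
vD = suc (suc (suc zero))

xyx : Fin 4 → Fin 4 → Word (Fin 4)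
xyx X Y = X ∷ Y ∷ X ∷ []

xyxFormula : Formula 4
xyxFormula =
  xyx vA vB ∷ xyx vA vC ∷ xyx vA vD ∷
  xyx vB vA ∷ xyx vB vC ∷ xyx vB vD ∷
  xyx vC vA ∷ xyx vC vB ∷ xyx vC vD ∷
  xyx vD vA ∷ xyx vD vB ∷ xyx vD vC ∷ []

module Submission where

-- Only the self-similarity f(3k) = 0, f(3k+1) = f(k), f(3k+2) = 1 of f is used; it is proved
-- first.  For any word w with these equations: three consecutive letters determine the
-- position mod 3 (synchronisation), so if xyx occurs with |x| ≥ 3 then |x| + |y| ≡ 0 (mod 3);
-- and factors of length ≤ 6 are prefixes of twelve explicit windows, which decides by
-- computation all questions about images of length ≤ 2.  Given an occurrence h, call X long
-- if |h(X)| ≥ 3.  Two long variables force the others to be long (lengths mod 3); one long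
-- variable forces three short images of equal length, and four short images are impossible,
-- both by the computation.  If all variables are long, all images have length ≡ 0 (mod 3)
-- and occur in one common phase, so keeping every third letter (desubstitution) gives an
-- occurrence with a shorter image of A.  Well-founded induction on |h(A)| concludes.

open import Defs
open import Data.Nat using (ℕ; zero; suc; _+_; _≤_; _<_; _≤′_; ≤′-refl; ≤′-step; z≤n; s≤s; _≤?_)
open import Data.Nat.Properties using (≤-trans; ≤-<-trans; ≤⇒≤′; n≤1+n; +-suc; +-identityʳ;
  suc-injective; ≰⇒>)
open import Data.Nat.Induction using (<-wellFounded)
open import Data.Fin using (Fin; zero; suc; _≟_)
open import Data.Fin.Properties using (all?; any?)
open import Data.List using ([]; _∷_; _++_; length; applyUpTo)
open import Data.List.Properties using (++-assoc; ++-identityʳ; concatMap-++; ∷-injective; map-upTo)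
open import Data.List.Relation.Unary.All using (All; []; _∷_)
open import Data.List.Relation.Binary.Prefix.Heterogeneous using (Prefix; []; _∷_)
open import Data.List.Relation.Binary.Prefix.Heterogeneous.Properties using (prefix?)
open import Data.Empty using (⊥; ⊥-elim)
open import Data.Unit using (⊤; tt)
open import Data.Product using (∃; ∃-syntax; _×_; _,_; proj₁; proj₂)
open import Function using (_∘_)
open import Induction.WellFounded using (Acc; acc)
open import Relation.Nullary using (Dec; ¬_; yes; no)
open import Relation.Nullary.Decidable using (toWitness; ¬?; _×-dec_; _→-dec_)
open import Relation.Binary.PropositionalEquality

-- 3n, defined so that 3(n+1) unfolds to three successors of 3n
triple : ℕ → ℕ
triple zero    = zero
triple (suc n) = suc (suc (suc (triple n)))

n≤triple : ∀ n → n ≤ triple n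
n≤triple zero    = z≤n
n≤triple (suc n) = s≤s (≤-trans (n≤triple n) (≤-trans (n≤1+n _) (n≤1+n _)))

triple-positive : ∀ n → 3 ≤ triple n → 1 ≤ n
triple-positive (suc n) _ = s≤s z≤n

n<triple : ∀ n → 1 ≤ n → n < triple n
n<triple (suc n) _ = s≤s (s≤s (≤-trans (n≤triple n) (n≤1+n _)))

σ-block : ∀ v k → k < length v →
  lookupD zero (extend σ v) (triple k) ≡ zero ×
  lookupD zero (extend σ v) (suc (triple k)) ≡ lookupD zero v k ×
  lookupD zero (extend σ v) (suc (suc (triple k))) ≡ suc zero
σ-block (zero     ∷ v) zero    _       = refl , refl , refl
σ-block (suc zero ∷ v) zero    _       = refl , refl , refl
σ-block (zero     ∷ v) (suc k) (s≤s p) = σ-block v k p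
σ-block (suc zero ∷ v) (suc k) (s≤s p) = σ-block v k p

length-σ : ∀ v → length (extend σ v) ≡ triple (length v)
length-σ []             = refl
length-σ (zero     ∷ v) = cong (λ k → suc (suc (suc k))) (length-σ v)
length-σ (suc zero ∷ v) = cong (λ k → suc (suc (suc k))) (length-σ v)

length-σ^ : ∀ n → n < length (σ^ n [0])
length-σ^ zero    = s≤s z≤n
length-σ^ (suc n) rewrite length-σ (σ^ n [0]) =
  ≤-trans (s≤s (length-σ^ n)) (n<triple _ (≤-trans (s≤s z≤n) (length-σ^ n)))

-- σⁿ(0) is a prefix of σⁿ⁺¹(0), because σ(0) begins with 0
σ^-grows : ∀ n → ∃ λ ys → σ^ suc n [0] ≡ σ^ n [0] ++ ys
σ^-grows zero    = _ , refl
σ^-grows (suc n) with σ^-grows n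
... | ys , e = extend σ ys , trans (cong (extend σ) e) (concatMap-++ σ (σ^ n [0]) ys)

σ^-prefix : ∀ {m n} → m ≤′ n → ∃ λ ys → σ^ n [0] ≡ σ^ m [0] ++ ys
σ^-prefix ≤′-refl = [] , sym (++-identityʳ _)
σ^-prefix {m} (≤′-step {n} m≤n) with σ^-prefix m≤n | σ^-grows n
... | ys , e | zs , f = ys ++ zs , trans f (trans (cong (_++ zs) e) (++-assoc (σ^ m [0]) ys zs))

lookup-++ : ∀ {A : Set} (d : A) xs ys {k} → k < length xs → lookupD d (xs ++ ys) k ≡ lookupD d xs k
lookup-++ d (x ∷ xs) ys {zero}  _       = refl
lookup-++ d (x ∷ xs) ys {suc k} (s≤s p) = lookup-++ d xs ys p

σ^-long : ∀ {n k} → k ≤ n → k < length (σ^ n [0])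
σ^-long {n} k≤n = ≤-<-trans k≤n (length-σ^ n)

σ^-fixpoint : ∀ {n k} → k ≤ n → lookupD zero (σ^ n [0]) k ≡ fixpoint k
σ^-fixpoint {n} {k} k≤n = trans (stable (≤⇒≤′ k≤n)) (sym (stable (≤′-step ≤′-refl)))
  where
  stable : ∀ {m} → k ≤′ m → lookupD zero (σ^ m [0]) k ≡ lookupD zero (σ^ k [0]) k
  stable k≤m with σ^-prefix k≤m
  ... | ys , e rewrite e = lookup-++ zero (σ^ k [0]) ys (length-σ^ k)

-- The self-similarity of the fixed point: f(3k) = 0, f(3k+1) = f(k), f(3k+2) = 1.
-- Position 3k + r of f is read in σ(σ^(3k+r)(0)), whose k-th block is σ applied to f(k).
fixpoint-3k : ∀ k → fixpoint (triple k) ≡ zero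
fixpoint-3k k = proj₁ (σ-block (σ^ triple k [0]) k (σ^-long (n≤triple k)))

fixpoint-3k+1 : ∀ k → fixpoint (suc (triple k)) ≡ fixpoint k
fixpoint-3k+1 k = trans (proj₁ (proj₂ (σ-block (σ^ suc (triple k) [0]) k (σ^-long k≤)))) (σ^-fixpoint k≤)
  where
  k≤ : k ≤ suc (triple k)
  k≤ = ≤-trans (n≤triple k) (n≤1+n _)

fixpoint-3k+2 : ∀ k → fixpoint (suc (suc (triple k))) ≡ suc zero
fixpoint-3k+2 k = proj₂ (proj₂ (σ-block (σ^ suc (suc (triple k)) [0]) k (σ^-long k≤)))
  where
  k≤ : k ≤ suc (suc (triple k))
  k≤ = ≤-trans (n≤triple k) (≤-trans (n≤1+n _) (n≤1+n _))

-- Arithmetic modulo 3 on Fin 3: rot is +1, res n is n mod 3.  The finite facts about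
-- ℤ/3ℤ below are checked by evaluating all cases.
rot : Fin 3 → Fin 3
rot zero             = suc zero
rot (suc zero)       = suc (suc zero)
rot (suc (suc zero)) = zero

infixl 6 _⊕_
_⊕_ : Fin 3 → Fin 3 → Fin 3
zero             ⊕ y = y
suc zero         ⊕ y = rot y
suc (suc zero)   ⊕ y = rot (rot y)

res : ℕ → Fin 3
res zero    = zero
res (suc n) = rot (res n)

rot-⊕ : ∀ x y → rot x ⊕ y ≡ rot (x ⊕ y)
rot-⊕ = toWitness {a? = all? λ x → all? λ y → rot x ⊕ y ≟ rot (x ⊕ y)} _

res-+ : ∀ m n → res (m + n) ≡ res m ⊕ res n
res-+ zero    n = refl
res-+ (suc m) n = trans (cong rot (res-+ m n)) (sym (rot-⊕ (res m) (res n)))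

x⊕0 : ∀ x → x ⊕ zero ≡ x
x⊕0 = toWitness {a? = all? λ x → x ⊕ zero ≟ x} _

cancel : ∀ a b c → a ≡ a ⊕ b ⊕ c → b ⊕ c ≡ zero
cancel = toWitness {a? = all? λ a → all? λ b → all? λ c → (a ≟ a ⊕ b ⊕ c) →-dec (b ⊕ c ≟ zero)} _

-- in ℤ/3ℤ, 2 is invertible: pairwise sums vanishing forces each summand to vanish
pairwise-zero : ∀ a b c → a ⊕ b ≡ zero → a ⊕ c ≡ zero → b ⊕ c ≡ zero → c ≡ zero
pairwise-zero = toWitness {a? = all? λ a → all? λ b → all? λ c →
  (a ⊕ b ≟ zero) →-dec (a ⊕ c ≟ zero) →-dec (b ⊕ c ≟ zero) →-dec (c ≟ zero)} _

inverse-unique : ∀ d a b → d ⊕ a ≡ zero → d ⊕ b ≡ zero → a ≡ b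
inverse-unique = toWitness {a? = all? λ d → all? λ a → all? λ b →
  (d ⊕ a ≟ zero) →-dec (d ⊕ b ≟ zero) →-dec (a ≟ b)} _

base : Fin 3 → ℕ → ℕ
base zero             k = triple k
base (suc zero)       k = suc (triple k)
base (suc (suc zero)) k = suc (suc (triple k))

decompose : ∀ n → ∃ λ k → n ≡ base (res n) k
decompose zero = zero , refl
decompose (suc n) with res n | decompose n
... | zero           | k , e = k , cong suc e
... | suc zero       | k , e = k , cong suc e
... | suc (suc zero) | k , e = suc k , cong suc e

at-phase : ∀ n {p} → res n ≡ p → ∃ λ k → n ≡ base p k
at-phase n refl = decompose n

applyUpTo-cong : ∀ {A : Set} {f g : ℕ → A} → (∀ k → f k ≡ g k) → ∀ n → applyUpTo f n ≡ applyUpTo g n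
applyUpTo-cong f≗g zero    = refl
applyUpTo-cong f≗g (suc n) = cong₂ _∷_ (f≗g 0) (applyUpTo-cong (λ k → f≗g (suc k)) n)

segment-suc : ∀ {A : Set} (w : InfWord A) i n → segment w i (suc n) ≡ w i ∷ segment w (suc i) n
segment-suc w i n = begin
  segment w i (suc n)                               ≡⟨ map-upTo (λ k → w (i + k)) (suc n) ⟩
  w (i + 0) ∷ applyUpTo (λ k → w (i + suc k)) n     ≡⟨ cong₂ _∷_ (cong w (+-identityʳ i))
                                                         (applyUpTo-cong (λ k → cong w (+-suc i k)) n) ⟩
  w i ∷ applyUpTo (λ k → w (suc i + k)) n           ≡⟨ cong (w i ∷_) (sym (map-upTo (λ k → w (suc i + k)) n)) ⟩
  w i ∷ segment w (suc i) n                         ∎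
  where open ≡-Reasoning

-- the phase (position mod 3) of a window of three letters of w, read off its letters:
-- phase 0 reads 0?1, phase 1 reads ?10, phase 2 reads 10?  (000 and 111 never occur)
phaseOf : Bit → Bit → Bit → Fin 3
phaseOf zero       _          (suc zero) = zero
phaseOf _          (suc zero) zero       = suc zero
phaseOf (suc zero) zero       _          = suc (suc zero)
phaseOf _          _          _          = zero

-- the six letters starting at a position of phase p; a and b are the letters of the
-- underlying preimage that are not determined by the phase
window : Fin 3 → Bit → Bit → Word Bit
window zero             a b = zero ∷ a ∷ suc zero ∷ zero ∷ b ∷ suc zero ∷ []
window (suc zero)       a b = a ∷ suc zero ∷ zero ∷ b ∷ suc zero ∷ zero ∷ []
window (suc (suc zero)) a b = suc zero ∷ zero ∷ a ∷ suc zero ∷ zero ∷ b ∷ []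

MayOccur : Word Bit → Set
MayOccur u = ∃[ p ] ∃[ a ] ∃[ b ] Prefix _≡_ u (window p a b)

mayOccur? : ∀ u → Dec (MayOccur u)
mayOccur? u = any? λ p → any? λ a → any? λ b → prefix? _≟_ u (window p a b)

-- the word xyx; it is definitionally the image extend h (xyx X Y) when x = h X, y = h Y
xyxWord : Word Bit → Word Bit → Word Bit
xyxWord x y = x ++ (y ++ (x ++ []))

Compatible : Word Bit → Word Bit → Set
Compatible x y = MayOccur (xyxWord x y) × MayOccur (xyxWord y x)

compatible? : ∀ x y → Dec (Compatible x y)
compatible? x y = mayOccur? (xyxWord x y) ×-dec mayOccur? (xyxWord y x)

short : Fin 6 → Word Bit
short zero                               = zero ∷ []
short (suc zero)                         = suc zero ∷ []
short (suc (suc zero))                   = zero ∷ zero ∷ []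
short (suc (suc (suc zero)))             = zero ∷ suc zero ∷ []
short (suc (suc (suc (suc zero))))       = suc zero ∷ zero ∷ []
short (suc (suc (suc (suc (suc zero))))) = suc zero ∷ suc zero ∷ []

short-cover : ∀ u → u ≢ [] → length u < 3 → ∃ λ s → u ≡ short s
short-cover []                     u≢[] _ = ⊥-elim (u≢[] refl)
short-cover (zero ∷ [])            _    _ = zero , refl
short-cover (suc zero ∷ [])        _    _ = suc zero , refl
short-cover (zero ∷ zero ∷ [])     _    _ = suc (suc zero) , refl
short-cover (zero ∷ suc zero ∷ []) _    _ = suc (suc (suc zero)) , refl
short-cover (suc zero ∷ zero ∷ []) _    _ = suc (suc (suc (suc zero))) , refl
short-cover (suc zero ∷ suc zero ∷ []) _ _ = suc (suc (suc (suc (suc zero)))) , refl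
short-cover (_ ∷ _ ∷ _ ∷ _)        _    (s≤s (s≤s (s≤s ())))

short-residue : ∀ s → res (length (short s)) ≢ zero
short-residue = toWitness {a? = all? λ s → ¬? (res (length (short s)) ≟ zero)} _

short-xyx : ∀ s t → length (xyxWord (short s) (short t)) ≤ 6
short-xyx = toWitness {a? = all? λ s → all? λ t → length (xyxWord (short s) (short t)) ≤? 6} _

SameResidue : Word Bit → Word Bit → Set
SameResidue x y = res (length x) ≡ res (length y)

no-short-triple : ∀ a b c → ¬ (Compatible (short a) (short b) × Compatible (short a) (short c) ×
  Compatible (short b) (short c) × SameResidue (short a) (short b) × SameResidue (short b) (short c))
no-short-triple = toWitness {a? = all? λ a → all? λ b → all? λ c → ¬? (
  compatible? (short a) (short b) ×-dec compatible? (short a) (short c) ×-dec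
  compatible? (short b) (short c) ×-dec
  (res (length (short a)) ≟ res (length (short b))) ×-dec (res (length (short b)) ≟ res (length (short c))))} _

no-short-quadruple : ∀ a b c d → ¬ (Compatible (short a) (short b) × Compatible (short a) (short c) ×
  Compatible (short a) (short d) × Compatible (short b) (short c) × Compatible (short b) (short d) ×
  Compatible (short c) (short d))
no-short-quadruple = toWitness {a? = all? λ a → all? λ b → all? λ c → all? λ d → ¬? (
  compatible? (short a) (short b) ×-dec compatible? (short a) (short c) ×-dec
  compatible? (short a) (short d) ×-dec compatible? (short b) (short c) ×-dec
  compatible? (short b) (short d) ×-dec compatible? (short c) (short d))} _

-- Cut u into blocks of three letters; for a word starting at a position of
-- phase p, pick p selects from each block the letter at a position ≡ 1 (mod 3), which is the
-- letter f(k) of the preimage.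
pick : Fin 3 → Bit → Bit → Bit → Bit
pick zero             x y z = y
pick (suc zero)       x y z = x
pick (suc (suc zero)) x y z = z

desubst : Fin 3 → Word Bit → Word Bit
desubst p (x ∷ y ∷ z ∷ u) = pick p x y z ∷ desubst p u
desubst p _               = []

desubst-++ : ∀ p m u v → length u ≡ triple m → desubst p (u ++ v) ≡ desubst p u ++ desubst p v
desubst-++ p zero    []              v _ = refl
desubst-++ p (suc m) (x ∷ y ∷ z ∷ u) v e =
  cong (pick p x y z ∷_) (desubst-++ p m u v (suc-injective (suc-injective (suc-injective e))))

length-desubst : ∀ p m u → length u ≡ triple m → length (desubst p u) ≡ m
length-desubst p zero    []              _ = refl
length-desubst p (suc m) (x ∷ y ∷ z ∷ u) e =
  cong suc (length-desubst p m u (suc-injective (suc-injective (suc-injective e))))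

module SelfSimilar (w : InfWord Bit)
  (w-3k   : ∀ k → w (triple k) ≡ zero)
  (w-3k+1 : ∀ k → w (suc (triple k)) ≡ w k)
  (w-3k+2 : ∀ k → w (suc (suc (triple k))) ≡ suc zero) where

  _occursAt_ : Word Bit → ℕ → Set
  []      occursAt i = ⊤
  (x ∷ u) occursAt i = w i ≡ x × u occursAt suc i

  factor→occurs : ∀ u {i} → segment w i (length u) ≡ u → u occursAt i
  factor→occurs []      _ = tt
  factor→occurs (x ∷ u) {i} e with ∷-injective (trans (sym (segment-suc w i (length u))) e)
  ... | wi≡x , rest = wi≡x , factor→occurs u rest

  occurs→factor : ∀ u {i} → u occursAt i → segment w i (length u) ≡ u
  occurs→factor []      _            = refl
  occurs→factor (x ∷ u) {i} (wi≡x , p) = trans (segment-suc w i (length u)) (cong₂ _∷_ wi≡x (occurs→factor u p))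

  occurs-++ : ∀ u v {i} → (u ++ v) occursAt i → u occursAt i × v occursAt (i + length u)
  occurs-++ []      v {i} p       = tt , subst (v occursAt_) (sym (+-identityʳ i)) p
  occurs-++ (x ∷ u) v {i} (e , p) with occurs-++ u v p
  ... | pu , pv = (e , pu) , subst (v occursAt_) (sym (+-suc i (length u))) pv

  phaseOf-base : ∀ p k → phaseOf (w (base p k)) (w (suc (base p k))) (w (suc (suc (base p k)))) ≡ p
  phaseOf-base zero k rewrite w-3k k | w-3k+2 k = refl
  phaseOf-base (suc zero) k rewrite w-3k+2 k | w-3k (suc k) = phase1 (w (suc (triple k)))
    where
    phase1 : ∀ a → phaseOf a (suc zero) zero ≡ suc zero
    phase1 zero       = refl
    phase1 (suc zero) = refl
  phaseOf-base (suc (suc zero)) k rewrite w-3k+2 k | w-3k (suc k) = refl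

  phaseOf-at : ∀ n → phaseOf (w n) (w (suc n)) (w (suc (suc n))) ≡ res n
  phaseOf-at n with decompose n
  ... | k , n≡ = trans (cong (λ m → phaseOf (w m) (w (suc m)) (w (suc (suc m)))) n≡) (phaseOf-base (res n) k)

  sync : ∀ u {i j} → 3 ≤ length u → u occursAt i → u occursAt j → res i ≡ res j
  sync (_ ∷ [])     (s≤s ())
  sync (_ ∷ _ ∷ []) (s≤s (s≤s ()))
  sync (a ∷ b ∷ c ∷ u) {i} {j} _ (ai , bi , ci , _) (aj , bj , cj , _) =
    trans (sym (phase i ai bi ci)) (phase j aj bj cj)
    where
    phase : ∀ n → w n ≡ a → w (suc n) ≡ b → w (suc (suc n)) ≡ c → phaseOf a b c ≡ res n
    phase n refl refl refl = phaseOf-at n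

  xyx-split : ∀ x y {i} → xyxWord x y occursAt i →
    x occursAt i × y occursAt (i + length x) × x occursAt (i + length x + length y)
  xyx-split x y p with occurs-++ x _ p
  ... | px , q with occurs-++ y _ q
  ... | py , r = px , py , proj₁ (occurs-++ x [] r)

  -- if xyx occurs and |x| ≥ 3 then |x| + |y| ≡ 0 (mod 3): both copies of x have the same phase
  xyx-congruence : ∀ x y {i} → 3 ≤ length x → xyxWord x y occursAt i → res (length x) ⊕ res (length y) ≡ zero
  xyx-congruence x y {i} long p with xyx-split x y p
  ... | px , _ , px′ = cancel (res i) (res (length x)) (res (length y)) (begin
    res i                                          ≡⟨ sync x long px px′ ⟩
    res (i + length x + length y)                  ≡⟨ res-+ (i + length x) (length y) ⟩
    res (i + length x) ⊕ res (length y)            ≡⟨ cong (_⊕ res (length y)) (res-+ i (length x)) ⟩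
    res i ⊕ res (length x) ⊕ res (length y)        ∎)
    where open ≡-Reasoning

  window-at : ∀ i → ∃[ p ] ∃[ a ] ∃[ b ] window p a b occursAt i
  window-at i with decompose i
  ... | k , i≡ = res i , subst (λ n → ∃[ a ] ∃[ b ] window (res i) a b occursAt n) (sym i≡) (at-base (res i))
    where
    at-base : ∀ p → ∃[ a ] ∃[ b ] window p a b occursAt base p k
    at-base zero = w k , w (suc k) ,
      w-3k k , w-3k+1 k , w-3k+2 k , w-3k (suc k) , w-3k+1 (suc k) , w-3k+2 (suc k) , tt
    at-base (suc zero) = w k , w (suc k) ,
      w-3k+1 k , w-3k+2 k , w-3k (suc k) , w-3k+1 (suc k) , w-3k+2 (suc k) , w-3k (suc (suc k)) , tt
    at-base (suc (suc zero)) = w (suc k) , w (suc (suc k)) ,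
      w-3k+2 k , w-3k (suc k) , w-3k+1 (suc k) , w-3k+2 (suc k) , w-3k (suc (suc k)) , w-3k+1 (suc (suc k)) , tt

  occurs-prefix : ∀ u t {i} → u occursAt i → t occursAt i → length u ≤ length t → Prefix _≡_ u t
  occurs-prefix []      t       _         _         _       = []
  occurs-prefix (x ∷ u) (y ∷ t) (refl , p) (refl , q) (s≤s l) = refl ∷ occurs-prefix u t p q l

  may-occur : ∀ u {i} → u occursAt i → length u ≤ 6 → MayOccur u
  may-occur u {i} p l with window-at i
  ... | q , a , b , t = q , a , b , occurs-prefix u (window q a b) p t (bound q)
    where
    bound : ∀ q → length u ≤ length (window q a b)
    bound zero             = l
    bound (suc zero)       = l
    bound (suc (suc zero)) = l

  -- position in the preimage of the first letter picked by desubst p at position 3k + p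
  offset : Fin 3 → ℕ → ℕ
  offset zero             k = k
  offset (suc zero)       k = k
  offset (suc (suc zero)) k = suc k

  desubst-occurs : ∀ p k u → u occursAt base p k → desubst p u occursAt offset p k
  desubst-occurs zero k (x ∷ y ∷ z ∷ u) (_ , wy , _ , rest) =
    trans (sym (w-3k+1 k)) wy , desubst-occurs zero (suc k) u rest
  desubst-occurs (suc zero) k (x ∷ y ∷ z ∷ u) (wx , _ , _ , rest) =
    trans (sym (w-3k+1 k)) wx , desubst-occurs (suc zero) (suc k) u rest
  desubst-occurs (suc (suc zero)) k (x ∷ y ∷ z ∷ u) (_ , _ , wz , rest) =
    trans (sym (w-3k+1 (suc k))) wz , desubst-occurs (suc (suc zero)) (suc k) u rest
  desubst-occurs p k []          _ = tt
  desubst-occurs p k (_ ∷ [])     _ = tt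
  desubst-occurs p k (_ ∷ _ ∷ []) _ = tt

  NonErasing : (Fin 4 → Word Bit) → Set
  NonErasing h = ∀ X → h X ≢ []

  XYXFactors : (Fin 4 → Word Bit) → Set
  XYXFactors h = ∀ X Y → X ≢ Y → Factor (xyxWord (h X) (h Y)) w

  -- An occurrence h, whose variables are sorted into long (|h(X)| ≥ 3) and short ones.
  -- Every distribution of long variables except "all long" is contradictory.
  module Occurrence (h : Fin 4 → Word Bit) (nonErasing : NonErasing h) (factors : XYXFactors h) where

    Long : Fin 4 → Set
    Long X = 3 ≤ length (h X)

    ρ : Fin 4 → Fin 3
    ρ X = res (length (h X))

    xyx-at : ∀ X Y → X ≢ Y → ∃ λ i → xyxWord (h X) (h Y) occursAt i
    xyx-at X Y X≢Y with factors X Y X≢Y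
    ... | i , e = i , factor→occurs _ e

    congruence : ∀ X Y → X ≢ Y → Long X → ρ X ⊕ ρ Y ≡ zero
    congruence X Y X≢Y long = xyx-congruence (h X) (h Y) long (proj₂ (xyx-at X Y X≢Y))

    third-divisible : ∀ X Y Z → X ≢ Y → X ≢ Z → Y ≢ Z → Long X → Long Y → ρ Z ≡ zero
    third-divisible X Y Z X≢Y X≢Z Y≢Z lX lY =
      pairwise-zero (ρ X) (ρ Y) (ρ Z) (congruence X Y X≢Y lX) (congruence X Z X≢Z lX) (congruence Y Z Y≢Z lY)

    short-image : ∀ X → ¬ Long X → ∃ λ s → h X ≡ short s
    short-image X notLong = short-cover (h X) (nonErasing X) (≰⇒> notLong)

    compatible : ∀ {X Y s t} → X ≢ Y → h X ≡ short s → h Y ≡ short t → Compatible (short s) (short t)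
    compatible X≢Y eX eY = xyx-mayOccur X≢Y eX eY , xyx-mayOccur (X≢Y ∘ sym) eY eX
      where
      xyx-mayOccur : ∀ {X Y s t} → X ≢ Y → h X ≡ short s → h Y ≡ short t → MayOccur (xyxWord (short s) (short t))
      xyx-mayOccur {X} {Y} {s} {t} X≢Y eX eY with xyx-at X Y X≢Y
      ... | i , occ = may-occur _ (subst₂ (λ x y → xyxWord x y occursAt i) eX eY occ) (short-xyx s t)

    -- two long variables and a short one: the short length would be ≡ 0 (mod 3)
    two-long-one-short : ∀ X Y Z → X ≢ Y → X ≢ Z → Y ≢ Z → Long X → Long Y → ¬ Long Z → ⊥
    two-long-one-short X Y Z X≢Y X≢Z Y≢Z lX lY nZ with short-image Z nZ
    ... | s , eZ = short-residue s
      (subst (λ u → res (length u) ≡ zero) eZ (third-divisible X Y Z X≢Y X≢Z Y≢Z lX lY))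

    -- one long variable: the three short images have equal residues, excluded by computation
    one-long : ∀ D X Y Z → D ≢ X → D ≢ Y → D ≢ Z → X ≢ Y → X ≢ Z → Y ≢ Z →
               Long D → ¬ Long X → ¬ Long Y → ¬ Long Z → ⊥
    one-long D X Y Z D≢X D≢Y D≢Z X≢Y X≢Z Y≢Z lD nX nY nZ
      with short-image X nX | short-image Y nY | short-image Z nZ
    ... | a , eX | b , eY | c , eZ = no-short-triple a b c
      (compatible X≢Y eX eY , compatible X≢Z eX eZ , compatible Y≢Z eY eZ ,
       same D≢X D≢Y eX eY , same D≢Y D≢Z eY eZ)
      where
      -- the residues of |h(U)| and |h(V)| are both opposite to that of |h(D)|
      same : ∀ {U V s t} → D ≢ U → D ≢ V → h U ≡ short s → h V ≡ short t → SameResidue (short s) (short t)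
      same {U} {V} D≢U D≢V eU eV = subst₂ SameResidue eU eV
        (inverse-unique (ρ D) (ρ U) (ρ V) (congruence D U D≢U lD) (congruence D V D≢V lD))

    no-long : ¬ Long vA → ¬ Long vB → ¬ Long vC → ¬ Long vD → ⊥
    no-long nA nB nC nD with short-image vA nA | short-image vB nB | short-image vC nC | short-image vD nD
    ... | a , eA | b , eB | c , eC | d , eD = no-short-quadruple a b c d
      (compatible (λ ()) eA eB , compatible (λ ()) eA eC , compatible (λ ()) eA eD ,
       compatible (λ ()) eB eC , compatible (λ ()) eB eD , compatible (λ ()) eC eD)

    module AllLong (long : ∀ X → Long X) where

      divisible : ∀ X → ρ X ≡ zero
      divisible zero                   = third-divisible vB vC vA (λ ()) (λ ()) (λ ()) (long vB) (long vC)
      divisible (suc zero)             = third-divisible vA vC vB (λ ()) (λ ()) (λ ()) (long vA) (long vC)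
      divisible (suc (suc zero))       = third-divisible vA vB vC (λ ()) (λ ()) (λ ()) (long vA) (long vB)
      divisible (suc (suc (suc zero))) = third-divisible vA vB vD (λ ()) (λ ()) (λ ()) (long vA) (long vB)

      m : Fin 4 → ℕ
      m X = proj₁ (at-phase (length (h X)) (divisible X))

      length≡ : ∀ X → length (h X) ≡ triple (m X)
      length≡ X = proj₂ (at-phase (length (h X)) (divisible X))

      m-positive : ∀ X → 1 ≤ m X
      m-positive X = triple-positive (m X) (subst (3 ≤_) (length≡ X) (long X))

      -- the phase p of a fixed occurrence of h(A) is the phase of every occurrence of every image
      i₀ : ℕ
      i₀ = proj₁ (xyx-at vA vB (λ ()))

      occA₀ : h vA occursAt i₀
      occA₀ = proj₁ (xyx-split (h vA) (h vB) (proj₂ (xyx-at vA vB (λ ()))))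

      p : Fin 3
      p = res i₀

      -- h(X) occurs in phase p: for X ≠ A it follows a copy of h(A) in h(A)h(X)h(A)
      witness : ∀ X → ∃ λ j → h X occursAt j × res j ≡ p
      witness zero    = i₀ , occA₀ , refl
      witness (suc X) with xyx-at vA (suc X) (λ ())
      ... | j , occ with xyx-split (h vA) (h (suc X)) occ
      ... | occA , occX , _ = j + length (h vA) , occX , (begin
        res (j + length (h vA))  ≡⟨ res-+ j (length (h vA)) ⟩
        res j ⊕ ρ vA             ≡⟨ cong (res j ⊕_) (divisible vA) ⟩
        res j ⊕ zero             ≡⟨ x⊕0 (res j) ⟩
        res j                    ≡⟨ sync (h vA) (long vA) occA occA₀ ⟩
        p                        ∎)
        where open ≡-Reasoning

      phase : ∀ X {i} → h X occursAt i → res i ≡ p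
      phase X occ with witness X
      ... | j , occ′ , res-j≡p = trans (sync (h X) (long X) occ occ′) res-j≡p

      h′ : Fin 4 → Word Bit
      h′ X = desubst p (h X)

      length-h′ : ∀ X → length (h′ X) ≡ m X
      length-h′ X = length-desubst p (m X) (h X) (length≡ X)

      nonErasing′ : NonErasing h′
      nonErasing′ X e = 1≰0 (subst (1 ≤_) (trans (sym (length-h′ X)) (cong length e)) (m-positive X))
        where
        1≰0 : ¬ (1 ≤ 0)
        1≰0 ()

      -- desubstitution acts blockwise, since every image consists of whole blocks
      desubst-xyx : ∀ X Y → desubst p (xyxWord (h X) (h Y)) ≡ xyxWord (h′ X) (h′ Y)
      desubst-xyx X Y = begin
        desubst p (h X ++ (h Y ++ (h X ++ [])))    ≡⟨ desubst-++ p (m X) (h X) _ (length≡ X) ⟩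
        h′ X ++ desubst p (h Y ++ (h X ++ []))     ≡⟨ cong (h′ X ++_) (desubst-++ p (m Y) (h Y) _ (length≡ Y)) ⟩
        h′ X ++ (h′ Y ++ desubst p (h X ++ []))    ≡⟨ cong (λ u → h′ X ++ (h′ Y ++ u)) (desubst-++ p (m X) (h X) [] (length≡ X)) ⟩
        h′ X ++ (h′ Y ++ (h′ X ++ []))             ∎
        where open ≡-Reasoning

      factors′ : XYXFactors h′
      factors′ X Y X≢Y with xyx-at X Y X≢Y
      ... | i , occ with at-phase i (phase X (proj₁ (xyx-split (h X) (h Y) occ)))
      ... | k , i≡ = offset p k , occurs→factor _ (subst (_occursAt offset p k) (desubst-xyx X Y)
                       (desubst-occurs p k _ (subst (xyxWord (h X) (h Y) occursAt_) i≡ occ)))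

      shorter : length (h′ vA) < length (h vA)
      shorter = subst₂ _<_ (sym (length-h′ vA)) (sym (length≡ vA)) (n<triple (m vA) (m-positive vA))

    -- Assuming that no occurrence has a shorter image
    -- of A, all long is impossible by desubstitution and every other pattern is impossible
    -- by the lemmas above.
    step : (∀ h′ → length (h′ vA) < length (h vA) → NonErasing h′ → XYXFactors h′ → ⊥) → ⊥
    step smaller-impossible
      with 3 ≤? length (h vA) | 3 ≤? length (h vB) | 3 ≤? length (h vC) | 3 ≤? length (h vD)
    ... | yes a | yes b | yes c | yes d =
      smaller-impossible (AllLong.h′ long) (AllLong.shorter long) (AllLong.nonErasing′ long) (AllLong.factors′ long)
      where
      long : ∀ X → Long X
      long zero                   = a
      long (suc zero)             = b
      long (suc (suc zero))       = c
      long (suc (suc (suc zero))) = d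
    ... | yes a | yes b | yes c | no d  = two-long-one-short vA vB vD (λ ()) (λ ()) (λ ()) a b d
    ... | yes a | yes b | no c  | _     = two-long-one-short vA vB vC (λ ()) (λ ()) (λ ()) a b c
    ... | yes a | no b  | yes c | _     = two-long-one-short vA vC vB (λ ()) (λ ()) (λ ()) a c b
    ... | no a  | yes b | yes c | _     = two-long-one-short vB vC vA (λ ()) (λ ()) (λ ()) b c a
    ... | yes a | no b  | no c  | yes d = two-long-one-short vA vD vB (λ ()) (λ ()) (λ ()) a d b
    ... | no a  | yes b | no c  | yes d = two-long-one-short vB vD vA (λ ()) (λ ()) (λ ()) b d a
    ... | no a  | no b  | yes c | yes d = two-long-one-short vC vD vA (λ ()) (λ ()) (λ ()) c d a
    ... | yes a | no b  | no c  | no d  = one-long vA vB vC vD (λ ()) (λ ()) (λ ()) (λ ()) (λ ()) (λ ()) a b c d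
    ... | no a  | yes b | no c  | no d  = one-long vB vA vC vD (λ ()) (λ ()) (λ ()) (λ ()) (λ ()) (λ ()) b a c d
    ... | no a  | no b  | yes c | no d  = one-long vC vA vB vD (λ ()) (λ ()) (λ ()) (λ ()) (λ ()) (λ ()) c a b d
    ... | no a  | no b  | no c  | yes d = one-long vD vA vB vC (λ ()) (λ ()) (λ ()) (λ ()) (λ ()) (λ ()) d a b c
    ... | no a  | no b  | no c  | no d  = no-long a b c d

  no-occurrence : ∀ h → NonErasing h → XYXFactors h → ⊥
  no-occurrence h = go h (<-wellFounded (length (h vA)))
    where
    go : ∀ h → Acc _<_ (length (h vA)) → NonErasing h → XYXFactors h → ⊥
    go h (acc smaller) nonErasing factors =
      Occurrence.step h nonErasing factors (λ h′ lt → go h′ (smaller lt))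

fragments : ∀ (w : InfWord Bit) (h : Fin 4 → Word Bit) → All (λ φ → Factor (extend h φ) w) xyxFormula →
  ∀ X Y → X ≢ Y → Factor (xyxWord (h X) (h Y)) w
fragments w h (AB ∷ AC ∷ AD ∷ BA ∷ BC ∷ BD ∷ CA ∷ CB ∷ CD ∷ DA ∷ DB ∷ DC ∷ []) = pair
  where
  pair : ∀ X Y → X ≢ Y → Factor (xyxWord (h X) (h Y)) w
  pair zero                   zero                   X≢X = ⊥-elim (X≢X refl)
  pair zero                   (suc zero)             _   = AB
  pair zero                   (suc (suc zero))       _   = AC
  pair zero                   (suc (suc (suc zero))) _   = AD
  pair (suc zero)             zero                   _   = BA
  pair (suc zero)             (suc zero)             X≢X = ⊥-elim (X≢X refl)
  pair (suc zero)             (suc (suc zero))       _   = BC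
  pair (suc zero)             (suc (suc (suc zero))) _   = BD
  pair (suc (suc zero))       zero                   _   = CA
  pair (suc (suc zero))       (suc zero)             _   = CB
  pair (suc (suc zero))       (suc (suc zero))       X≢X = ⊥-elim (X≢X refl)
  pair (suc (suc zero))       (suc (suc (suc zero))) _   = CD
  pair (suc (suc (suc zero))) zero                   _   = DA
  pair (suc (suc (suc zero))) (suc zero)             _   = DB
  pair (suc (suc (suc zero))) (suc (suc zero))       _   = DC
  pair (suc (suc (suc zero))) (suc (suc (suc zero))) X≢X = ⊥-elim (X≢X refl)

theorem16 : Avoids fixpoint xyxFormula
theorem16 (h , nonErasing , occurs) =
  SelfSimilar.no-occurrence fixpoint fixpoint-3k fixpoint-3k+1 fixpoint-3k+2
    h nonErasing (fragments fixpoint h occurs)
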